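{- Let $q,a_1$ be integers with $q\geq 2$ and $|a_1|\leq 2\sqrt{q}$. If the pair $q,a_1$ is supersingular, then $-a_n=\lfloor 2\sqrt{q}^{\,n}\rfloor$ for some positive integer $n$ if and only if $$a_1\in\{0,\sqrt{q},\pm\sqrt{2q},\pm\sqrt{3q},-2\sqrt{q}\}.$$ Moreover, if such an integer $n$ exists, then there exist infinitely many such $n$.
   Context: Let $\sqrt{q}>0$. Let $\alpha\in\mathbb{C}$ be a root of $X^2-a_1X+q$ with $\arg(\alpha)\in[0,\pi]$, let $\bar\alpha$ be its complex conjugate, and for integers $n\geq 0$ set $a_n=\alpha^n+\bar\alpha^n$ (equivalently $a_0=2$ and $a_{n+1}=a_1a_n-qa_{n-1}$). Let $\beta=\alpha/\sqrt{q}$. The pair $q,a_1$ is called supersingular if $\beta$ is a root of unity, and ordinary otherwise. -}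

module Defs where

open import Data.Nat using (ℕ; zero; suc)
open import Data.Integer using (ℤ; +_; -_; _+_; _-_; _*_; _^_; _≤_; _<_)
open import Data.Product using (_×_)
open import Data.Sum using (_⊎_)
open import Relation.Binary.PropositionalEquality using (_≡_)

-- The sequence a_n : a_0 = 2, a_1 = a₁, a_{n+1} = a₁ a_n - q a_{n-1}.
-- (a_n = αⁿ + ᾱⁿ.)
aSeq : ℤ → ℤ → ℕ → ℤ
aSeq q a₁ zero = + 2
aSeq q a₁ (suc zero) = a₁
aSeq q a₁ (suc (suc n)) = a₁ * aSeq q a₁ (suc n) - q * aSeq q a₁ n

-- Exact arithmetic in ℤ[α] ⊂ ℂ, where α is the root of X² - a₁X + q with
-- arg α ∈ [0, π].  Under a₁² ≤ 4q we have α = (a₁ + i√D)/2, D = 4q - a₁² ≥ 0.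
-- An element A·α + B (A, B ∈ ℤ) is stored as the pair (A , B).
-- Powers: αᵏ = powA k · α + powB k, using α² = a₁α - q.
powA : ℤ → ℤ → ℕ → ℤ
powB : ℤ → ℤ → ℕ → ℤ
powA q a₁ zero = + 0
powA q a₁ (suc k) = a₁ * powA q a₁ k + powB q a₁ k
powB q a₁ zero = + 1
powB q a₁ (suc k) = - (q * powA q a₁ k)

-- A·α + B = c (as complex numbers), c ∈ ℤ:
--   real parts:      A·a₁/2 + B = c
--   imaginary parts: A·√D/2 = 0, i.e. A·D = 0.
EvalEq : ℤ → ℤ → ℤ → ℤ → ℤ → Set
EvalEq q a₁ A B c =
  (A * a₁ + + 2 * B ≡ + 2 * c) × (A * (+ 4 * q - a₁ * a₁) ≡ + 0)

-- β = α/√q is a root of unity  ⇔  ∃ m ≥ 1, β^(2m) = 1  ⇔  ∃ m ≥ 1, α^(2m) = q^m.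
Supersingular : ℤ → ℤ → Set
Supersingular q a₁ =
  Data.Product.∃ λ (m : ℕ) →
    EvalEq q a₁ (powA q a₁ (2 Data.Nat.* suc m)) (powB q a₁ (2 Data.Nat.* suc m))
           (q ^ suc m)
  where import Data.Nat; import Data.Product

-- m = ⌊ 2 √q ^ n ⌋ = ⌊ √(4 qⁿ) ⌋   ⇔   0 ≤ m, m² ≤ 4qⁿ < (m+1)².
IsFloor2SqrtqPow : ℤ → ℕ → ℤ → Set
IsFloor2SqrtqPow q n m =
  (+ 0 ≤ m) × (m * m ≤ + 4 * q ^ n) × (+ 4 * q ^ n < (m + + 1) * (m + + 1))

Cond : ℤ → ℤ → ℕ → Set
Cond q a₁ n = IsFloor2SqrtqPow q n (- aSeq q a₁ n)

InSet : ℤ → ℤ → Set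
InSet q a₁ =
  (a₁ ≡ + 0)
  ⊎ ((+ 0 ≤ a₁) × (a₁ * a₁ ≡ q))
  ⊎ (a₁ * a₁ ≡ + 2 * q)
  ⊎ (a₁ * a₁ ≡ + 3 * q)
  ⊎ ((a₁ ≤ + 0) × (a₁ * a₁ ≡ + 4 * q))

{-# OPTIONS --safe #-}
-- Supersingularity means α^(2m) = q^m for some m ≥ 1, or else a₁² = 4q.  In the first case
-- the traces of the powers of α² (trace t = a₁² - 2q, norm q²) satisfy a₍ₘ₊₂₎ = q^(m+1) t;
-- α²/q is then a root of unity whose trace t/q is rational, hence integral, so a₁² = k q
-- with 0 ≤ k ≤ 4.  Writing α = √q β, the admissible values of a₁ are those for which βⁿ = -1
-- for some n: then a_n = -2√qⁿ = -⌊2√qⁿ⌋, and this recurs with the period of β.  For the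
-- excluded values a₁ = -√q and a₁ = 2√q one gets a_n ∈ {2√qⁿ, -√qⁿ} and a_n = 2√qⁿ, never
-- the negated floor.
module Submission where

open import Defs
open import Data.Nat using (ℕ)
open import Data.Integer using (ℤ; +_; _*_; _≤_)
open import Data.Product using (_×_; ∃)
open import Function.Bundles using (_⇔_)

import Data.Nat
open import Data.Nat as ℕ using (zero; suc)
import Data.Nat.Properties as ℕₚ
open import Data.Nat.Coprimality as Coprime using (Coprime; coprime-divisor)
open import Data.Nat.Divisibility as ℕ∣ using (∣1⇒≡1)
open import Data.Nat.Primality using (euclidsLemma; prime[2])
open import Data.Nat.Tactic.RingSolver using () renaming (solve-∀ to ℕ-solve-∀)
open import Data.Integer using (NonZero; ≢-nonZero; -_; _+_; _-_; _^_; _<_; ∣_∣; +≤+; +<+; -≤+; -[1+_]; +[1+_])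
open import Data.Integer.Properties
open import Data.Integer.Divisibility.Signed using (_∣_; ∣ᵤ⇒∣)
open import Data.Integer.Tactic.RingSolver using (solve-∀)
import Data.Rational as ℚ
open import Data.Rational.Properties using (toℚᵘ-fromℚᵘ)
open import Data.Rational.Unnormalised using (mkℚᵘ) renaming (_≃_ to _≃ᵘ_)
open import Data.Rational.Unnormalised.Properties using (drop-*≡*)
open import Data.Product using (_,_; ∃₂; proj₁; proj₂)
open import Data.Sum using (_⊎_; inj₁; inj₂; [_,_]′)
open import Data.Empty using (⊥-elim)
open import Function using (_∘_; id)
open import Function.Bundles using (mk⇔)
open import Relation.Nullary using (¬_)
open import Relation.Binary.PropositionalEquality

aSeq-shift : ∀ q a₁ P c → aSeq q a₁ P ≡ c * + 2 → aSeq q a₁ (suc P) ≡ c * a₁ →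
             ∀ n → aSeq q a₁ (n ℕ.+ P) ≡ c * aSeq q a₁ n
aSeq-shift q a₁ P c aₚ≡2c aₚ₊₁≡ca₁ zero = aₚ≡2c
aSeq-shift q a₁ P c aₚ≡2c aₚ₊₁≡ca₁ (suc zero) = aₚ₊₁≡ca₁
aSeq-shift q a₁ P c aₚ≡2c aₚ₊₁≡ca₁ (suc (suc n)) = begin
  a₁ * aSeq q a₁ (suc n ℕ.+ P) - q * aSeq q a₁ (n ℕ.+ P)
    ≡⟨ cong₂ (λ x y → a₁ * x - q * y) (aSeq-shift q a₁ P c aₚ≡2c aₚ₊₁≡ca₁ (suc n))
                                       (aSeq-shift q a₁ P c aₚ≡2c aₚ₊₁≡ca₁ n) ⟩
  a₁ * (c * aSeq q a₁ (suc n)) - q * (c * aSeq q a₁ n)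
    ≡⟨ pull-out a₁ q c (aSeq q a₁ (suc n)) (aSeq q a₁ n) ⟩
  c * aSeq q a₁ (suc (suc n)) ∎
  where
  open ≡-Reasoning
  pull-out : ∀ a q c x y → a * (c * x) - q * (c * y) ≡ c * (a * x - q * y)
  pull-out = solve-∀

aSeq-periodic : ∀ q a₁ P → aSeq q a₁ P ≡ + 2 → aSeq q a₁ (suc P) ≡ a₁ →
                ∀ n j → aSeq q a₁ (n ℕ.+ j ℕ.* P) ≡ aSeq q a₁ n
aSeq-periodic q a₁ P aₚ≡2 aₚ₊₁≡a₁ n zero = cong (aSeq q a₁) (ℕₚ.+-identityʳ n)
aSeq-periodic q a₁ P aₚ≡2 aₚ₊₁≡a₁ n (suc j) = begin
  aSeq q a₁ (n ℕ.+ (P ℕ.+ j ℕ.* P))  ≡⟨ cong (aSeq q a₁) (regroup n P (j ℕ.* P)) ⟩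
  aSeq q a₁ ((n ℕ.+ j ℕ.* P) ℕ.+ P)  ≡⟨ aSeq-shift q a₁ P (+ 1) aₚ≡2 aₚ₊₁≡1*a₁ (n ℕ.+ j ℕ.* P) ⟩
  + 1 * aSeq q a₁ (n ℕ.+ j ℕ.* P)    ≡⟨ *-identityˡ _ ⟩
  aSeq q a₁ (n ℕ.+ j ℕ.* P)          ≡⟨ aSeq-periodic q a₁ P aₚ≡2 aₚ₊₁≡a₁ n j ⟩
  aSeq q a₁ n                        ∎
  where
  open ≡-Reasoning
  aₚ₊₁≡1*a₁ : aSeq q a₁ (suc P) ≡ + 1 * a₁
  aₚ₊₁≡1*a₁ = trans aₚ₊₁≡a₁ (sym (*-identityˡ a₁))
  regroup : ∀ n p k → n ℕ.+ (p ℕ.+ k) ≡ n ℕ.+ k ℕ.+ p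
  regroup = ℕ-solve-∀

aSeq-scale : ∀ c y x n → aSeq (c * c * y) (c * x) n ≡ c ^ n * aSeq y x n
aSeq-scale c y x zero = refl
aSeq-scale c y x (suc zero) = cx≡c¹x c x
  where
  cx≡c¹x : ∀ c x → c * x ≡ c * + 1 * x
  cx≡c¹x = solve-∀
aSeq-scale c y x (suc (suc n)) =
  trans (cong₂ (λ u v → c * x * u - c * c * y * v) (aSeq-scale c y x (suc n)) (aSeq-scale c y x n))
        (pull-out c x y (c ^ n) (aSeq y x (suc n)) (aSeq y x n))
  where
  pull-out : ∀ c x y p u v → c * x * (c * p * u) - c * c * y * (p * v) ≡ c * (c * p) * (x * u - y * v)
  pull-out = solve-∀

aSeq-double : ∀ q a₁ k → aSeq q a₁ (2 ℕ.* k) ≡ aSeq (q * q) (aSeq q a₁ 2) k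
aSeq-double q a₁ zero = refl
aSeq-double q a₁ (suc zero) = refl
aSeq-double q a₁ (suc (suc k)) = begin
  aSeq q a₁ (2 ℕ.* suc (suc k))
    ≡⟨ cong (aSeq q a₁) (trans (ℕₚ.*-suc 2 (suc k)) (cong (2 ℕ.+_) (ℕₚ.*-suc 2 k))) ⟩
  aSeq q a₁ (4 ℕ.+ 2 ℕ.* k)
    ≡⟨ two-steps a₁ q (aSeq q a₁ (suc (2 ℕ.* k))) (aSeq q a₁ (2 ℕ.* k)) ⟩
  t * aSeq q a₁ (2 ℕ.+ 2 ℕ.* k) - q * q * aSeq q a₁ (2 ℕ.* k)
    ≡⟨ cong₂ (λ u v → t * u - q * q * v)
         (trans (cong (aSeq q a₁) (sym (ℕₚ.*-suc 2 k))) (aSeq-double q a₁ (suc k))) (aSeq-double q a₁ k) ⟩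
  aSeq (q * q) t (suc (suc k)) ∎
  where
  open ≡-Reasoning
  t : ℤ
  t = aSeq q a₁ 2
  two-steps : ∀ a q x₁ x₀ → a * (a * (a * x₁ - q * x₀) - q * x₁) - q * (a * x₁ - q * x₀)
                          ≡ (a * a - q * + 2) * (a * x₁ - q * x₀) - q * q * x₀
  two-steps = solve-∀

aSeq≡pow-mod-norm : ∀ y x k → ∃ λ f → aSeq y x (suc k) ≡ x ^ suc k + f * y
aSeq≡pow-mod-norm y x zero = + 0 , x≡x¹+0 x y
  where
  x≡x¹+0 : ∀ x y → x ≡ x * + 1 + + 0 * y
  x≡x¹+0 = solve-∀
aSeq≡pow-mod-norm y x (suc k) with aSeq≡pow-mod-norm y x k
... | f , eq = x * f - aSeq y x k ,
  trans (cong (λ u → x * u - y * aSeq y x k) eq) (regroup x y (x ^ suc k) f (aSeq y x k))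
  where
  regroup : ∀ x y p f a → x * (p + f * y) - y * a ≡ x * p + (x * f - a) * y
  regroup = solve-∀

aSeq-trace : ∀ q a₁ n → aSeq q a₁ n ≡ a₁ * powA q a₁ n + + 2 * powB q a₁ n
aSeq-trace q a₁ zero = base₀ a₁
  where
  base₀ : ∀ a → + 2 ≡ a * + 0 + + 2 * + 1
  base₀ = solve-∀
aSeq-trace q a₁ (suc zero) = base₁ q a₁
  where
  base₁ : ∀ q a → a ≡ a * (a * + 0 + + 1) + + 2 * (- (q * + 0))
  base₁ = solve-∀
aSeq-trace q a₁ (suc (suc n)) =
  trans (cong₂ (λ x y → a₁ * x - q * y) (aSeq-trace q a₁ (suc n)) (aSeq-trace q a₁ n))
        (recurrence q a₁ (powA q a₁ n) (powB q a₁ n))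
  where
  recurrence : ∀ q a A B → a * (a * (a * A + B) + + 2 * (- (q * A))) - q * (a * A + + 2 * B)
                   ≡ a * (a * (a * A + B) + (- (q * A))) + + 2 * (- (q * (a * A + B)))
  recurrence = solve-∀

aSeq-shift-by-αPower : ∀ q a₁ P c → powA q a₁ P ≡ + 0 → powB q a₁ P ≡ c →
                       ∀ n → aSeq q a₁ (n ℕ.+ P) ≡ c * aSeq q a₁ n
aSeq-shift-by-αPower q a₁ P c A≡0 B≡c = aSeq-shift q a₁ P c
  (trans (aSeq-trace q a₁ P) (trans (cong₂ (λ A B → a₁ * A + + 2 * B) A≡0 B≡c) (value₀ a₁ c)))
  (trans (aSeq-trace q a₁ (suc P))
         (trans (cong₂ (λ A B → a₁ * (a₁ * A + B) + + 2 * (- (q * A))) A≡0 B≡c) (value₁ q a₁ c)))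
  where
  value₀ : ∀ a c → a * + 0 + + 2 * c ≡ c * + 2
  value₀ = solve-∀
  value₁ : ∀ q a c → a * (a * + 0 + c) + + 2 * (- (q * + 0)) ≡ c * a
  value₁ = solve-∀

square-nonneg : ∀ a → + 0 ≤ a * a
square-nonneg (+ n)    = subst (+ 0 ≤_) (pos-* n n) (+≤+ ℕ.z≤n)
square-nonneg -[1+ n ] = +≤+ ℕ.z≤n

pos-^ : ∀ s n → (+ s) ^ n ≡ + (s ℕ.^ n)
pos-^ s zero = refl
pos-^ s (suc n) = trans (cong (+ s *_) (pos-^ s n)) (sym (pos-* s (s ℕ.^ n)))

^-distribʳ-* : ∀ x y n → (x * y) ^ n ≡ x ^ n * y ^ n
^-distribʳ-* x y zero = refl
^-distribʳ-* x y (suc n) = trans (cong (x * y *_) (^-distribʳ-* x y n)) (interchange x y (x ^ n) (y ^ n))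
  where
  interchange : ∀ a b c d → a * b * (c * d) ≡ a * c * (b * d)
  interchange = solve-∀

even-of-square≡4* : ∀ a q → a * a ≡ + 4 * q → ∃ λ x → a ≡ x * + 2 × q ≡ x * x
even-of-square≡4* a q a²≡4q = x , a≡2x , q≡x²
  where
  2∣∣a∣ : 2 ℕ∣.∣ ∣ a ∣
  2∣∣a∣ = [ id , id ]′ (euclidsLemma ∣ a ∣ ∣ a ∣ prime[2] (ℕ∣.divides (2 ℕ.* ∣ q ∣) ∣a∣²≡2∣q∣*2))
    where
    four-times : ∀ m → 4 ℕ.* m ≡ 2 ℕ.* m ℕ.* 2
    four-times = ℕ-solve-∀
    ∣a∣²≡2∣q∣*2 : ∣ a ∣ ℕ.* ∣ a ∣ ≡ 2 ℕ.* ∣ q ∣ ℕ.* 2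
    ∣a∣²≡2∣q∣*2 = trans (sym (abs-* a a)) (trans (cong ∣_∣ a²≡4q) (trans (abs-* (+ 4) q) (four-times ∣ q ∣)))
  2∣a : + 2 ∣ a
  2∣a = ∣ᵤ⇒∣ 2∣∣a∣
  x : ℤ
  x = _∣_.quotient 2∣a
  a≡2x : a ≡ x * + 2
  a≡2x = _∣_.equality 2∣a
  q≡x² : q ≡ x * x
  q≡x² = sym (*-cancelˡ-≡ (+ 4) (x * x) q (trans (quadruple x) (trans (sym (cong₂ _*_ a≡2x a≡2x)) a²≡4q)))
    where
    quadruple : ∀ x → + 4 * (x * x) ≡ x * + 2 * (x * + 2)
    quadruple = solve-∀

lowest-terms : ∀ t Q .{{_ : ℕ.NonZero Q}} → ∃₂ λ u v → Coprime v ∣ u ∣ × u * + Q ≡ t * + v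
lowest-terms t (suc q₀) = numerator-denominator (t ℚ./ suc q₀) (toℚᵘ-fromℚᵘ (mkℚᵘ t q₀))
  where
  numerator-denominator : ∀ r → ℚ.toℚᵘ r ≃ᵘ mkℚᵘ t q₀ →
                          ∃₂ λ u v → Coprime v ∣ u ∣ × u * + suc q₀ ≡ t * + v
  numerator-denominator (ℚ.mkℚ u d-1 u⊥d) r≃t/q =
    u , suc d-1 , Coprime.sym (Coprime.recompute u⊥d) , drop-*≡* r≃t/q

coprime-divisor-^ : ∀ {v} u n → Coprime v ∣ u ∣ → v ℕ∣.∣ ∣ u ^ n ∣ → v ℕ∣.∣ 1
coprime-divisor-^ u zero _ v∣1 = v∣1
coprime-divisor-^ {v} u (suc n) v⊥u v∣uⁿ⁺¹ =
  coprime-divisor-^ u n v⊥u (coprime-divisor v⊥u (subst (v ℕ∣.∣_) (abs-* u (u ^ n)) v∣uⁿ⁺¹))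

-- Rescaling by v/Q turns (a_k) into the integral Lucas sequence of trace u and norm v²,
-- whose k-th term is uᵏ modulo v²; the hypothesis then makes v divide u^(m+2).
lucas-period⇒t≡uQ : ∀ t Q .{{_ : ℕ.NonZero Q}} m u v → Coprime v ∣ u ∣ → u * + Q ≡ t * + v →
  aSeq (+ Q * + Q) t (suc (suc m)) ≡ (+ Q) ^ suc m * t → t ≡ u * + Q
lucas-period⇒t≡uQ t Q m u v v⊥u uQ≡tv aₘ₊₂≡Qᵐ⁺¹t = begin
    t          ≡⟨ *-identityʳ t ⟨
    t * + 1    ≡⟨ cong (λ d → t * + d) (∣1⇒≡1 (coprime-divisor-^ u (suc (suc m)) v⊥u v∣uᵐ⁺²)) ⟨
    t * V      ≡⟨ uQ≡tv ⟨
    u * q      ∎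
  where
  open ≡-Reasoning
  q V : ℤ
  q = + Q
  V = + v
  Vt≡Qu : V * t ≡ q * u
  Vt≡Qu = trans (*-comm V t) (trans (sym uQ≡tv) (*-comm u q))
  rescale : ∀ k → V ^ k * aSeq (q * q) t k ≡ q ^ k * aSeq (V * V) u k
  rescale k = begin
    V ^ k * aSeq (q * q) t k          ≡⟨ aSeq-scale V (q * q) t k ⟨
    aSeq (V * V * (q * q)) (V * t) k  ≡⟨ cong₂ (λ y x → aSeq y x k) (swap V q) Vt≡Qu ⟩
    aSeq (q * q * (V * V)) (q * u) k  ≡⟨ aSeq-scale q (V * V) u k ⟩
    q ^ k * aSeq (V * V) u k          ∎
    where
    swap : ∀ a b → a * a * (b * b) ≡ b * b * (a * a)
    swap = solve-∀
  instance
    qᵐ⁺²≢0 : NonZero (q ^ suc (suc m))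
    qᵐ⁺²≢0 = ≢-nonZero (λ eq → ℕ.≢-nonZero⁻¹ Q (cong ∣_∣ (i^n≡0⇒i≡0 q (suc (suc m)) eq)))
  top : aSeq (V * V) u (suc (suc m)) ≡ V ^ suc m * u
  top = *-cancelˡ-≡ (q ^ suc (suc m)) _ _ (begin
    q ^ suc (suc m) * aSeq (V * V) u (suc (suc m))  ≡⟨ rescale (suc (suc m)) ⟨
    V ^ suc (suc m) * aSeq (q * q) t (suc (suc m))  ≡⟨ cong (V ^ suc (suc m) *_) aₘ₊₂≡Qᵐ⁺¹t ⟩
    V ^ suc (suc m) * (q ^ suc m * t)               ≡⟨ regroup V t (V ^ m) (q ^ suc m) ⟩
    q ^ suc m * (V ^ suc m) * (V * t)               ≡⟨ cong (q ^ suc m * V ^ suc m *_) Vt≡Qu ⟩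
    q ^ suc m * (V ^ suc m) * (q * u)               ≡⟨ regroup′ q u (q ^ suc m) (V ^ suc m) ⟩
    q ^ suc (suc m) * (V ^ suc m * u)               ∎)
    where
    regroup : ∀ V t p r → V * (V * p) * (r * t) ≡ r * (V * p) * (V * t)
    regroup = solve-∀
    regroup′ : ∀ Q u r p → r * p * (Q * u) ≡ Q * r * (p * u)
    regroup′ = solve-∀
  f : ℤ
  f = proj₁ (aSeq≡pow-mod-norm (V * V) u (suc m))
  aₘ₊₂≡uᵐ⁺²+fV² : aSeq (V * V) u (suc (suc m)) ≡ u ^ suc (suc m) + f * (V * V)
  aₘ₊₂≡uᵐ⁺²+fV² = proj₂ (aSeq≡pow-mod-norm (V * V) u (suc m))
  uᵐ⁺²≡ : u ^ suc (suc m) ≡ (V ^ m * u - f * V) * V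
  uᵐ⁺²≡ = begin
    u ^ suc (suc m)                                   ≡⟨ add-sub (u ^ suc (suc m)) (f * (V * V)) ⟩
    u ^ suc (suc m) + f * (V * V) - f * (V * V)       ≡⟨ cong (_- f * (V * V)) (trans (sym aₘ₊₂≡uᵐ⁺²+fV²) top) ⟩
    V * V ^ m * u - f * (V * V)                       ≡⟨ factor f V (V ^ m) u ⟩
    (V ^ m * u - f * V) * V                           ∎
    where
    add-sub : ∀ x y → x ≡ x + y - y
    add-sub = solve-∀
    factor : ∀ f V p u → V * p * u - f * (V * V) ≡ (p * u - f * V) * V
    factor = solve-∀
  v∣uᵐ⁺² : v ℕ∣.∣ ∣ u ^ suc (suc m) ∣
  v∣uᵐ⁺² = ℕ∣.divides ∣ V ^ m * u - f * V ∣ (trans (cong ∣_∣ uᵐ⁺²≡) (abs-* (V ^ m * u - f * V) V))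

lucas-period⇒Q∣t : ∀ t Q .{{_ : ℕ.NonZero Q}} m →
  aSeq (+ Q * + Q) t (suc (suc m)) ≡ (+ Q) ^ suc m * t → ∃ λ u → t ≡ u * + Q
lucas-period⇒Q∣t t Q m aₘ₊₂≡Qᵐ⁺¹t =
  let u , v , v⊥u , uQ≡tv = lowest-terms t Q
  in u , lucas-period⇒t≡uQ t Q m u v v⊥u uQ≡tv aₘ₊₂≡Qᵐ⁺¹t

supersingular-cases : ∀ q a₁ → Supersingular q a₁ →
  a₁ * a₁ ≡ + 4 * q ⊎ ∃ λ m → powA q a₁ (2 ℕ.* suc m) ≡ + 0 × powB q a₁ (2 ℕ.* suc m) ≡ q ^ suc m
supersingular-cases q a₁ (m , real-part , imaginary-part)
  with i*j≡0⇒i≡0∨j≡0 (powA q a₁ (2 ℕ.* suc m)) imaginary-part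
... | inj₂ D≡0 = inj₁ (sym (i-j≡0⇒i≡j (+ 4 * q) (a₁ * a₁) D≡0))
... | inj₁ A≡0 = inj₂ (m , A≡0 , *-cancelˡ-≡ (+ 2) _ _ (trans (zero-coefficient a₁ B)
                                   (trans (cong (λ A → A * a₁ + + 2 * B) (sym A≡0)) real-part)))
  where
  B : ℤ
  B = powB q a₁ (2 ℕ.* suc m)
  zero-coefficient : ∀ a B → + 2 * B ≡ + 0 * a + + 2 * B
  zero-coefficient = solve-∀

square-class-of-multiple : ∀ Q .{{_ : ℕ.NonZero Q}} a₁ k → a₁ * a₁ ≤ + 4 * + Q → a₁ * a₁ ≡ k * + Q →
                           ∃ λ n → n ℕ.≤ 4 × a₁ * a₁ ≡ + n * + Q
square-class-of-multiple (suc q₀) a₁ (+ n) bound a²≡nQ = n , n≤4 , a²≡nQ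
  where
  n≤4 : n ℕ.≤ 4
  n≤4 = ℕₚ.*-cancelʳ-≤ n 4 (suc q₀)
          (drop‿+≤+ (subst₂ _≤_ (trans a²≡nQ (sym (pos-* n (suc q₀)))) (sym (pos-* 4 (suc q₀))) bound))
square-class-of-multiple (suc q₀) a₁ -[1+ n ] _ a²≡kQ with subst (+ 0 ≤_) a²≡kQ (square-nonneg a₁)
... | ()

supersingular⇒square-class : ∀ Q .{{_ : ℕ.NonZero Q}} a₁ → a₁ * a₁ ≤ + 4 * + Q → Supersingular (+ Q) a₁ →
                             ∃ λ n → n ℕ.≤ 4 × a₁ * a₁ ≡ + n * + Q
supersingular⇒square-class Q a₁ bound ss with supersingular-cases (+ Q) a₁ ss
... | inj₁ a²≡4Q = 4 , ℕₚ.≤-refl , a²≡4Q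
... | inj₂ (m , A≡0 , B≡Qᵐ⁺¹) = square-class-of-multiple Q a₁ (u + + 2) bound
                   (trans (add-back (a₁ * a₁) (+ Q)) (trans (cong (_+ + Q * + 2) t≡uQ) (factor u (+ Q))))
  where
  open ≡-Reasoning
  q t : ℤ
  q = + Q
  t = aSeq q a₁ 2
  even-terms : aSeq (q * q) t (suc (suc m)) ≡ q ^ suc m * t
  even-terms = begin
    aSeq (q * q) t (suc (suc m))    ≡⟨ aSeq-double q a₁ (suc (suc m)) ⟨
    aSeq q a₁ (2 ℕ.* suc (suc m))   ≡⟨ cong (aSeq q a₁) (ℕₚ.*-suc 2 (suc m)) ⟩
    aSeq q a₁ (2 ℕ.+ 2 ℕ.* suc m)   ≡⟨ aSeq-shift-by-αPower q a₁ (2 ℕ.* suc m) (q ^ suc m) A≡0 B≡Qᵐ⁺¹ 2 ⟩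
    q ^ suc m * t                   ∎
  u : ℤ
  u = proj₁ (lucas-period⇒Q∣t t Q m even-terms)
  t≡uQ : t ≡ u * q
  t≡uQ = proj₂ (lucas-period⇒Q∣t t Q m even-terms)
  add-back : ∀ x q → x ≡ (x - q * + 2) + q * + 2
  add-back = solve-∀
  factor : ∀ u q → u * q + q * + 2 ≡ (u + + 2) * q
  factor = solve-∀

isFloor-of-exact : ∀ q n m → + 0 ≤ m → m * m ≡ + 4 * q ^ n → IsFloor2SqrtqPow q n m
isFloor-of-exact q n (+ k) 0≤m m²≡4qⁿ =
  0≤m , ≤-reflexive m²≡4qⁿ , subst (_< (+ k + + 1) * (+ k + + 1)) m²≡4qⁿ k²<[k+1]²
  where
  k<k+1 : k ℕ.< k ℕ.+ 1
  k<k+1 = ℕₚ.m<m+n k ℕ.z<s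
  k²<[k+1]² : + k * + k < (+ k + + 1) * (+ k + + 1)
  k²<[k+1]² = subst₂ _<_ (pos-* k k) (pos-* (k ℕ.+ 1) (k ℕ.+ 1)) (+<+ (ℕₚ.*-mono-< k<k+1 k<k+1))

¬isFloor-of-root : ∀ q n X → + 1 ≤ X → X * X ≡ q ^ n → ¬ IsFloor2SqrtqPow q n X
¬isFloor-of-root q n (+ S) (+≤+ 1≤S) X²≡qⁿ (_ , _ , 4qⁿ<[X+1]²) =
  ℕₚ.<⇒≱ (drop‿+<+ (subst₂ _<_ 4qⁿ≡ (sym (pos-* (S ℕ.+ 1) (S ℕ.+ 1))) 4qⁿ<[X+1]²))
         (ℕₚ.≤-trans (ℕₚ.*-mono-≤ S+1≤2S S+1≤2S) (ℕₚ.≤-reflexive (double-square S)))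
  where
  S+1≤2S : S ℕ.+ 1 ℕ.≤ S ℕ.+ S
  S+1≤2S = ℕₚ.+-monoʳ-≤ S 1≤S
  4qⁿ≡ : + 4 * q ^ n ≡ + (4 ℕ.* (S ℕ.* S))
  4qⁿ≡ = trans (cong (+ 4 *_) (trans (sym X²≡qⁿ) (sym (pos-* S S)))) (sym (pos-* 4 (S ℕ.* S)))
  double-square : ∀ S → (S ℕ.+ S) ℕ.* (S ℕ.+ S) ≡ 4 ℕ.* (S ℕ.* S)
  double-square = ℕ-solve-∀

Solution : ℤ → ℤ → ℕ → Set
Solution q a₁ n = 1 ℕ.≤ n × Cond q a₁ n

Unbounded : (ℕ → Set) → Set
Unbounded P = ∀ N → ∃ λ n → N ℕ.≤ n × P n

cond-of-aSeq≡-2sⁿ : ∀ s a₁ n → aSeq (+ s * + s) a₁ n ≡ - (+ 2 * (+ s) ^ n) → Cond (+ s * + s) a₁ n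
cond-of-aSeq≡-2sⁿ s a₁ n aₙ≡-2sⁿ =
  subst (IsFloor2SqrtqPow q n) (sym (trans (cong -_ aₙ≡-2sⁿ) (neg-involutive (+ 2 * X))))
        (isFloor-of-exact q n (+ 2 * X) 0≤2X [2X]²≡4qⁿ)
  where
  q X : ℤ
  q = + s * + s
  X = (+ s) ^ n
  0≤2X : + 0 ≤ + 2 * X
  0≤2X = subst (+ 0 ≤_) (trans (pos-* 2 (s ℕ.^ n)) (cong (+ 2 *_) (sym (pos-^ s n)))) (+≤+ ℕ.z≤n)
  [2X]²≡4qⁿ : + 2 * X * (+ 2 * X) ≡ + 4 * q ^ n
  [2X]²≡4qⁿ = trans (square-double X) (cong (+ 4 *_) (sym (^-distribʳ-* (+ s) (+ s) n)))
    where
    square-double : ∀ x → + 2 * x * (+ 2 * x) ≡ + 4 * (x * x)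
    square-double = solve-∀

-- α = s β, where β has trace x and norm 1, β^P = 1 and β^(r+1) = -1.
solutions-of-scaled-root : ∀ s x P .{{_ : ℕ.NonZero P}} r →
  aSeq (+ 1) x P ≡ + 2 → aSeq (+ 1) x (suc P) ≡ x → aSeq (+ 1) x (suc r) ≡ - + 2 →
  Unbounded (Solution (+ s * + s) (+ s * x))
solutions-of-scaled-root s x P r bₚ≡2 bₚ₊₁≡x bᵣ₊₁≡-2 N =
  n , N≤n , ℕ.s≤s ℕ.z≤n , cond-of-aSeq≡-2sⁿ s (+ s * x) n (begin
    aSeq (+ s * + s) (+ s * x) n        ≡⟨ cong (λ y → aSeq y (+ s * x) n) (*-identityʳ (+ s * + s)) ⟨
    aSeq (+ s * + s * + 1) (+ s * x) n  ≡⟨ aSeq-scale (+ s) (+ 1) x n ⟩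
    (+ s) ^ n * aSeq (+ 1) x n          ≡⟨ cong ((+ s) ^ n *_) (aSeq-periodic (+ 1) x P bₚ≡2 bₚ₊₁≡x (suc r) N) ⟩
    (+ s) ^ n * aSeq (+ 1) x (suc r)    ≡⟨ cong ((+ s) ^ n *_) bᵣ₊₁≡-2 ⟩
    (+ s) ^ n * - + 2                   ≡⟨ times-minus-two ((+ s) ^ n) ⟩
    - (+ 2 * (+ s) ^ n)                 ∎)
  where
  open ≡-Reasoning
  n : ℕ
  n = suc r ℕ.+ N ℕ.* P
  N≤n : N ℕ.≤ n
  N≤n = ℕₚ.≤-trans (ℕₚ.m≤m*n N P) (ℕₚ.m≤n+m (N ℕ.* P) (suc r))
  times-minus-two : ∀ x → x * - + 2 ≡ - (+ 2 * x)
  times-minus-two = solve-∀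

solutions-a₁≡-2√q : ∀ s → Unbounded (Solution (+ s * + s) (- (+ 2 * + s)))
solutions-a₁≡-2√q s = subst (λ a₁ → Unbounded (Solution (+ s * + s) a₁)) (times-minus-two (+ s))
                        (solutions-of-scaled-root s (- + 2) 2 0 refl refl refl)
  where
  times-minus-two : ∀ x → x * - + 2 ≡ - (+ 2 * x)
  times-minus-two = solve-∀

solutions-a₁≡√q : ∀ s → Unbounded (Solution (+ s * + s) (+ s))
solutions-a₁≡√q s = subst (λ a₁ → Unbounded (Solution (+ s * + s) a₁)) (*-identityʳ (+ s))
                      (solutions-of-scaled-root s (+ 1) 6 2 refl refl refl)

solutions-of-square : ∀ q a₁ → Unbounded (Solution (q * q) (aSeq q a₁ 2)) → Unbounded (Solution q a₁)
solutions-of-square q a₁ solutions N with solutions N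
... | k , N≤k , 1≤k , 0≤m , m²≤ , <[m+1]² =
  2 ℕ.* k , ℕₚ.≤-trans N≤k (ℕₚ.m≤n*m k 2) , ℕₚ.≤-trans 1≤k (ℕₚ.m≤n*m k 2) ,
  subst (IsFloor2SqrtqPow q (2 ℕ.* k)) (cong -_ (sym (aSeq-double q a₁ k)))
        (0≤m , subst (λ p → m * m ≤ + 4 * p) [q*q]ᵏ≡q²ᵏ m²≤ ,
               subst (λ p → + 4 * p < (m + + 1) * (m + + 1)) [q*q]ᵏ≡q²ᵏ <[m+1]²)
  where
  m : ℤ
  m = - aSeq (q * q) (aSeq q a₁ 2) k
  [q*q]ᵏ≡q²ᵏ : (q * q) ^ k ≡ q ^ (2 ℕ.* k)
  [q*q]ᵏ≡q²ᵏ = trans (cong (λ p → (q * p) ^ k) (sym (*-identityʳ q))) (^-*-assoc q 2 k)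

solutions-a₁≡0 : ∀ Q → Unbounded (Solution (+ Q) (+ 0))
solutions-a₁≡0 Q = solutions-of-square (+ Q) (+ 0)
  (subst (λ t → Unbounded (Solution (+ Q * + Q) t)) t≡-2Q (solutions-a₁≡-2√q Q))
  where
  t≡-2Q : - (+ 2 * + Q) ≡ aSeq (+ Q) (+ 0) 2
  t≡-2Q = trace-of-square (+ Q)
    where
    trace-of-square : ∀ q → - (+ 2 * q) ≡ + 0 * + 0 - q * + 2
    trace-of-square = solve-∀

solutions-a₁²≡2q : ∀ Q a₁ → a₁ * a₁ ≡ + 2 * + Q → Unbounded (Solution (+ Q) a₁)
solutions-a₁²≡2q Q a₁ a₁²≡2Q = solutions-of-square (+ Q) a₁
  (subst₂ (λ q t → Unbounded (Solution q t)) (pos-* Q Q) t≡0 (solutions-a₁≡0 (Q ℕ.* Q)))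
  where
  t≡0 : + 0 ≡ a₁ * a₁ - + Q * + 2
  t≡0 = sym (trans (cong (_- + Q * + 2) a₁²≡2Q) (twice-minus-twice (+ Q)))
    where
    twice-minus-twice : ∀ q → + 2 * q - q * + 2 ≡ + 0
    twice-minus-twice = solve-∀

solutions-a₁²≡3q : ∀ Q a₁ → a₁ * a₁ ≡ + 3 * + Q → Unbounded (Solution (+ Q) a₁)
solutions-a₁²≡3q Q a₁ a₁²≡3Q = solutions-of-square (+ Q) a₁
  (subst (λ t → Unbounded (Solution (+ Q * + Q) t)) t≡Q (solutions-a₁≡√q Q))
  where
  t≡Q : + Q ≡ a₁ * a₁ - + Q * + 2
  t≡Q = sym (trans (cong (_- + Q * + 2) a₁²≡3Q) (thrice-minus-twice (+ Q)))
    where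
    thrice-minus-twice : ∀ q → + 3 * q - q * + 2 ≡ q
    thrice-minus-twice = solve-∀

solutions-a₁≡2x : ∀ x → x ≤ + 0 → Unbounded (Solution (x * x) (x * + 2))
solutions-a₁≡2x (+ 0) _ = solutions-a₁≡-2√q 0
solutions-a₁≡2x +[1+ _ ] (+≤+ ())
solutions-a₁≡2x -[1+ s ] _ =
  subst₂ (λ q a₁ → Unbounded (Solution q a₁)) (square-neg (+ suc s)) (double-neg (+ suc s))
         (solutions-a₁≡-2√q (suc s))
  where
  square-neg : ∀ x → x * x ≡ (- x) * (- x)
  square-neg = solve-∀
  double-neg : ∀ x → - (+ 2 * x) ≡ (- x) * + 2
  double-neg = solve-∀

inSet⇒unbounded : ∀ Q a₁ → InSet (+ Q) a₁ → Unbounded (Solution (+ Q) a₁)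
inSet⇒unbounded Q .(+ 0) (inj₁ refl) = solutions-a₁≡0 Q
inSet⇒unbounded Q (+ s) (inj₂ (inj₁ (_ , s²≡Q))) =
  subst (λ q → Unbounded (Solution q (+ s))) s²≡Q (solutions-a₁≡√q s)
inSet⇒unbounded Q a₁ (inj₂ (inj₂ (inj₁ a₁²≡2Q))) = solutions-a₁²≡2q Q a₁ a₁²≡2Q
inSet⇒unbounded Q a₁ (inj₂ (inj₂ (inj₂ (inj₁ a₁²≡3Q)))) = solutions-a₁²≡3q Q a₁ a₁²≡3Q
inSet⇒unbounded Q a₁ (inj₂ (inj₂ (inj₂ (inj₂ (a₁≤0 , a₁²≡4Q))))) =
  let x , a₁≡2x , Q≡x² = even-of-square≡4* a₁ (+ Q) a₁²≡4Q
      x≤0 = *-cancelʳ-≤-pos x (+ 0) (+ 2) (subst (_≤ + 0) a₁≡2x a₁≤0)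
  in subst₂ (λ q a → Unbounded (Solution q a)) (sym Q≡x²) (sym a₁≡2x) (solutions-a₁≡2x x x≤0)

¬cond-of-positive : ∀ q a₁ n → + 0 < aSeq q a₁ n → ¬ Cond q a₁ n
¬cond-of-positive q a₁ n 0<aₙ (0≤-aₙ , _) = <⇒≱ (neg-mono-< 0<aₙ) 0≤-aₙ

¬cond-of-aSeq≡-root : ∀ q a₁ n X → + 1 ≤ X → X * X ≡ q ^ n → aSeq q a₁ n ≡ - X → ¬ Cond q a₁ n
¬cond-of-aSeq≡-root q a₁ n X 1≤X X²≡qⁿ aₙ≡-X =
  ¬isFloor-of-root q n X 1≤X X²≡qⁿ ∘ subst (IsFloor2SqrtqPow q n) (trans (cong -_ aₙ≡-X) (neg-involutive X))

0<[1+s]ⁿ*2 : ∀ s n → + 0 < (+ suc s) ^ n * + 2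
0<[1+s]ⁿ*2 s n = subst (+ 0 <_) (trans (pos-* (suc s ℕ.^ n) 2) (cong (_* + 2) (sym (pos-^ (suc s) n))))
                 (+<+ (ℕₚ.<-≤-trans (ℕₚ.m^n>0 (suc s) n) (ℕₚ.m≤m*n (suc s ℕ.^ n) 2)))

¬solution-a₁≡2√q : ∀ w n → ¬ Cond (+[1+ w ] * +[1+ w ]) (+[1+ w ] * + 2) n
¬solution-a₁≡2√q w n = ¬cond-of-positive _ _ n (subst (+ 0 <_) (sym aₙ≡) (0<[1+s]ⁿ*2 w n))
  where
  open ≡-Reasoning
  X : ℤ
  X = +[1+ w ]
  aₙ≡ : aSeq (X * X) (X * + 2) n ≡ X ^ n * + 2
  aₙ≡ = begin
    aSeq (X * X) (X * + 2) n        ≡⟨ cong (λ y → aSeq y (X * + 2) n) (*-identityʳ (X * X)) ⟨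
    aSeq (X * X * + 1) (X * + 2) n  ≡⟨ aSeq-scale X (+ 1) (+ 2) n ⟩
    X ^ n * aSeq (+ 1) (+ 2) n      ≡⟨ cong (λ i → X ^ n * aSeq (+ 1) (+ 2) i) (ℕₚ.*-identityʳ n) ⟨
    X ^ n * aSeq (+ 1) (+ 2) (n ℕ.* 1) ≡⟨ cong (X ^ n *_) (aSeq-periodic (+ 1) (+ 2) 1 refl refl 0 n) ⟩
    X ^ n * + 2                     ∎

aSeq-cube-root : ∀ n → aSeq (+ 1) (- + 1) n ≡ + 2 ⊎ aSeq (+ 1) (- + 1) n ≡ - + 1
aSeq-cube-root 0 = inj₁ refl
aSeq-cube-root 1 = inj₂ refl
aSeq-cube-root 2 = inj₂ refl
aSeq-cube-root (suc (suc (suc n))) =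
  subst (λ b → b ≡ + 2 ⊎ b ≡ - + 1) (sym period) (aSeq-cube-root n)
  where
  period : aSeq (+ 1) (- + 1) (3 ℕ.+ n) ≡ aSeq (+ 1) (- + 1) n
  period = trans (cong (aSeq (+ 1) (- + 1)) (ℕₚ.+-comm 3 n)) (aSeq-periodic (+ 1) (- + 1) 3 refl refl n 1)

¬solution-a₁≡-√q : ∀ s n → ¬ Cond (-[1+ s ] * -[1+ s ]) -[1+ s ] n
¬solution-a₁≡-√q s n = [ twice-power , minus-power ]′ (aSeq-cube-root n)
  where
  X q : ℤ
  X = +[1+ s ]
  q = -[1+ s ] * -[1+ s ]
  aₙ≡ : aSeq q -[1+ s ] n ≡ X ^ n * aSeq (+ 1) (- + 1) n
  aₙ≡ = trans (cong₂ (λ y x → aSeq y x n) (square-neg X) (neg-as-product X)) (aSeq-scale X (+ 1) (- + 1) n)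
    where
    square-neg : ∀ x → (- x) * (- x) ≡ x * x * + 1
    square-neg = solve-∀
    neg-as-product : ∀ x → - x ≡ x * - + 1
    neg-as-product = solve-∀
  twice-power : aSeq (+ 1) (- + 1) n ≡ + 2 → ¬ Cond q -[1+ s ] n
  twice-power bₙ≡2 =
    ¬cond-of-positive q _ n (subst (+ 0 <_) (sym (trans aₙ≡ (cong (X ^ n *_) bₙ≡2))) (0<[1+s]ⁿ*2 s n))
  minus-power : aSeq (+ 1) (- + 1) n ≡ - + 1 → ¬ Cond q -[1+ s ] n
  minus-power bₙ≡-1 = ¬cond-of-aSeq≡-root q _ n (X ^ n) 1≤Xⁿ Xⁿ²≡qⁿ
    (trans aₙ≡ (trans (cong (X ^ n *_) bₙ≡-1) (times-minus-one (X ^ n))))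
    where
    1≤Xⁿ : + 1 ≤ X ^ n
    1≤Xⁿ = subst (+ 1 ≤_) (sym (pos-^ (suc s) n)) (+≤+ (ℕₚ.m^n>0 (suc s) n))
    Xⁿ²≡qⁿ : X ^ n * X ^ n ≡ q ^ n
    Xⁿ²≡qⁿ = sym (^-distribʳ-* X X n)
    times-minus-one : ∀ x → x * - + 1 ≡ - x
    times-minus-one = solve-∀

nonpositive-of-cond : ∀ q a₁ n x → a₁ ≡ x * + 2 → q ≡ x * x → Cond q a₁ n → a₁ ≤ + 0
nonpositive-of-cond q a₁ n (+ 0) a₁≡0 _ _ = ≤-reflexive a₁≡0
nonpositive-of-cond q a₁ n -[1+ x ] a₁≡2x _ _ = subst (_≤ + 0) (sym a₁≡2x) -≤+
nonpositive-of-cond q a₁ n +[1+ w ] a₁≡2x q≡x² cond =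
  ⊥-elim (¬solution-a₁≡2√q w n (subst₂ (λ q a → Cond q a n) q≡x² a₁≡2x cond))

square-class⇒inSet : ∀ q a₁ n k → k ℕ.≤ 4 → a₁ * a₁ ≡ + k * q → Cond q a₁ n → InSet q a₁
square-class⇒inSet q a₁ n 0 _ a₁²≡0 _ = inj₁ ([ id , id ]′ (i*j≡0⇒i≡0∨j≡0 a₁ a₁²≡0))
square-class⇒inSet q (+ s) n 1 _ a₁²≡q _ = inj₂ (inj₁ (+≤+ ℕ.z≤n , trans a₁²≡q (*-identityˡ q)))
square-class⇒inSet q -[1+ s ] n 1 _ a₁²≡q cond =
  ⊥-elim (¬solution-a₁≡-√q s n (subst (λ q → Cond q -[1+ s ] n) (sym (trans a₁²≡q (*-identityˡ q))) cond))
square-class⇒inSet q a₁ n 2 _ a₁²≡2q _ = inj₂ (inj₂ (inj₁ a₁²≡2q))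
square-class⇒inSet q a₁ n 3 _ a₁²≡3q _ = inj₂ (inj₂ (inj₂ (inj₁ a₁²≡3q)))
square-class⇒inSet q a₁ n 4 _ a₁²≡4q cond =
  let x , a₁≡2x , q≡x² = even-of-square≡4* a₁ q a₁²≡4q
  in inj₂ (inj₂ (inj₂ (inj₂ (nonpositive-of-cond q a₁ n x a₁≡2x q≡x² cond , a₁²≡4q))))
square-class⇒inSet q a₁ n (suc (suc (suc (suc (suc _))))) (ℕ.s≤s (ℕ.s≤s (ℕ.s≤s (ℕ.s≤s ())))) _ _

proposition3 : (q a₁ : ℤ) → + 2 ≤ q → a₁ * a₁ ≤ + 4 * q → Supersingular q a₁ →
    ((∃ λ (n : ℕ) → (1 Data.Nat.≤ n) × Cond q a₁ n) ⇔ InSet q a₁)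
    × ((∃ λ (n : ℕ) → (1 Data.Nat.≤ n) × Cond q a₁ n) →
       (N : ℕ) → ∃ λ (n : ℕ) → (N Data.Nat.≤ n) × (1 Data.Nat.≤ n) × Cond q a₁ n)
proposition3 (+ 0) _ (+≤+ ()) _ _
proposition3 -[1+ _ ] _ () _ _
proposition3 q@(+[1+ q₀ ]) a₁ _ bound supersingular =
  mk⇔ necessary sufficient , inSet⇒unbounded (suc q₀) a₁ ∘ necessary
  where
  necessary : ∃ (Solution q a₁) → InSet q a₁
  necessary (n , _ , cond) =
    let k , k≤4 , a₁²≡kq = supersingular⇒square-class (suc q₀) a₁ bound supersingular
    in square-class⇒inSet q a₁ n k k≤4 a₁²≡kq cond
  sufficient : InSet q a₁ → ∃ (Solution q a₁)
  sufficient inSet = let n , _ , solution = inSet⇒unbounded (suc q₀) a₁ inSet 0 in n , solution
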